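{- Suppose that every $C_7$-critical graph $H$ satisfies $e(H)\ge \frac{27v(H)-20}{23}$. Then every $G_{7,2}$-critical graph $G$ satisfies $e(G)\ge\frac{27v(G)-20}{15}$.
   Context: For a graph $X$, a graph $G$ is $X$-critical if $G$ admits no graph homomorphism to $X$ but every proper subgraph of $G$ does. $C_7$ is the cycle on $7$ vertices. For positive integers $p,q$ with $p/q\ge2$, $G_{p,q}$ is the graph on $\{0,\dots,p-1\}$ with $ij$ an edge iff $q\le|i-j|\le p-q$. $v(\cdot)$ and $e(\cdot)$ denote numbers of vertices and edges. -}

module Defs where

open import Data.Nat using (ℕ; zero; suc; _+_; _*_; _∸_; _≤_; _<_)
open import Data.Fin using (Fin; toℕ)
open import Data.Bool using (Bool; true; false; if_then_else_)
open import Data.List using (List; length; filterᵇ; allFin; concatMap; map)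
open import Data.Product using (Σ; _×_; _,_; ∃-syntax)
open import Relation.Binary.PropositionalEquality using (_≡_)
open import Relation.Nullary using (¬_)
open import Function.Definitions using (Injective)
open import Data.Nat using (_<ᵇ_)
open import Data.Bool using (_∧_)

record Graph : Set where
  field
    n     : ℕ
    adj   : Fin n → Fin n → Bool
    sym   : ∀ i j → adj i j ≡ adj j i
    irrefl : ∀ i → adj i i ≡ false
open Graph public

v : Graph → ℕ
v G = n G

e : Graph → ℕ
e G = length (filterᵇ (λ p → isEdge (Data.Product.proj₁ p) (Data.Product.proj₂ p))
                     (concatMap (λ i → map (λ j → (i , j)) (allFin (n G))) (allFin (n G))))
  where
  isEdge : Fin (n G) → Fin (n G) → Bool
  isEdge i j = (toℕ i <ᵇ toℕ j) ∧ adj G i j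

Hom : Graph → Graph → Set
Hom G X = Σ (Fin (n G) → Fin (n X)) λ f →
  ∀ i j → adj G i j ≡ true → adj X (f i) (f j) ≡ true

Subgraph : Graph → Graph → Set
Subgraph H G = Σ (Fin (n H) → Fin (n G)) λ f →
  Injective _≡_ _≡_ f × (∀ i j → adj H i j ≡ true → adj G (f i) (f j) ≡ true)

-- a proper subgraph: a subgraph with fewer vertices or fewer edges
ProperSubgraph : Graph → Graph → Set
ProperSubgraph H G = Subgraph H G × (v H + e H < v G + e G)

Critical : Graph → Graph → Set
Critical X G = ¬ Hom G X × (∀ H → ProperSubgraph H G → Hom H X)

dist : ℕ → ℕ → ℕ
dist a b = (a ∸ b) + (b ∸ a)

open import Data.Nat using (_≤ᵇ_)

circAdj : (p q : ℕ) → Fin p → Fin p → Bool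
circAdj p q i j = (q ≤ᵇ dist (toℕ i) (toℕ j)) ∧ (dist (toℕ i) (toℕ j) ≤ᵇ (p ∸ q))

open import Data.Nat.Properties using (+-comm; n∸n≡0)
open import Relation.Binary.PropositionalEquality using (cong; refl)

dist-sym : ∀ a b → dist a b ≡ dist b a
dist-sym a b = +-comm (a ∸ b) (b ∸ a)

dist-self : ∀ a → dist a a ≡ 0
dist-self a rewrite n∸n≡0 a = refl

G72 : Graph
G72 = record
  { n = 7
  ; adj = circAdj 7 2
  ; sym = λ i j → cong (λ d → (2 ≤ᵇ d) ∧ (d ≤ᵇ 5)) (dist-sym (toℕ i) (toℕ j))
  ; irrefl = λ i → cong (λ d → (2 ≤ᵇ d) ∧ (d ≤ᵇ 5)) (dist-self (toℕ i))
  }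

open import Data.Nat using (_≡ᵇ_)
open import Data.Bool using (_∨_)

cycAdj : Fin 7 → Fin 7 → Bool
cycAdj i j = (dist (toℕ i) (toℕ j) ≡ᵇ 1) ∨ (dist (toℕ i) (toℕ j) ≡ᵇ 6)

C7 : Graph
C7 = record
  { n = 7
  ; adj = cycAdj
  ; sym = λ i j → cong (λ d → (d ≡ᵇ 1) ∨ (d ≡ᵇ 6)) (dist-sym (toℕ i) (toℕ j))
  ; irrefl = λ i → cong (λ d → (d ≡ᵇ 1) ∨ (d ≡ᵇ 6)) (dist-self (toℕ i))
  }

-- Let S be G with every edge replaced by a path of length 3, so v(S) = v(G) + 2e(G) and e(S) = 3e(G).
-- Working in ℤ₇, multiplying a C₇-colouring of S by 3 gives a G₇,₂-colouring of G, so S is not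
-- C₇-colourable when G is G₇,₂-critical. Conversely, a G₇,₂-colouring of G minus one edge, multiplied by 5,
-- extends to S minus any edge of the corresponding path. As S has no isolated vertex, every proper subgraph
-- of S misses an edge of S, so S is C₇-critical; the assumed bound for S then reads
-- 27(v(G) + 2e(G)) ≤ 69e(G) + 20, which is the claimed bound for G.

module Submission where

open import Defs hiding (sym)
open import Data.Nat using (ℕ; suc; _+_; _*_; _≤_; _<_; _<ᵇ_; z≤n; s≤s)
open import Data.Nat.Properties
  using (<ᵇ⇒<; <⇒<ᵇ; <-asym; <-irrefl; ≤-trans; ≤∧≢⇒<; <⇒≤; <⇒≱; *-comm
        ; +-mono-≤; +-monoʳ-<; +-monoʳ-≤; *-monoʳ-≤; +-monoˡ-≤; +-cancelʳ-≤)
open import Data.Nat.DivMod using (_mod_)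
open import Data.Nat.Solver using (module +-*-Solver)
open import Data.Fin as Fin using (Fin; toℕ; punchIn; punchOut; _≟_; _↑ˡ_; _↑ʳ_; splitAt)
open import Data.Fin.Properties
  using (any?; all?; <-cmp; injective⇒≤; toℕ-injective; punchIn-injective; punchIn-mono-≤; punchIn-punchOut
        ; splitAt-↑ˡ; splitAt-↑ʳ; splitAt⁻¹-↑ˡ; splitAt⁻¹-↑ʳ)
open import Data.Bool using (Bool; true; false; T; _∧_; not)
open import Data.Bool.Properties using (T?; T-≡; T-∧) renaming (_≟_ to _≟ᵇ_)
open import Data.List using (List; []; _∷_; _++_; length; map; filterᵇ; allFin; concatMap; lookup; cartesianProduct)
open import Data.List.Properties using (length-map; length-tabulate; length-++)
open import Data.List.Membership.Propositional using (_∈_)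
open import Data.List.Membership.Propositional.Properties using (∈-∃++; ∈-filter⁺; ∈-filter⁻; ∈-concat⁺′; ∈-map⁺; ∈-map⁻; ∈-allFin; ∈-lookup)
open import Data.List.Relation.Unary.Any using (here; there; index)
open import Data.List.Relation.Unary.Any.Properties using (lookup-index)
import Data.List.Relation.Unary.All as All
open import Data.List.Relation.Unary.AllPairs using ([]; _∷_)
open import Data.List.Relation.Unary.Unique.Propositional using (Unique)
import Data.List.Relation.Unary.Unique.Propositional.Properties as Unique
open import Data.List.Relation.Binary.Subset.Propositional using (_⊆_)
open import Data.Product.Properties using (≡-dec)
open import Data.Product using (∃; ∃₂; ∃-syntax; _×_; _,_; proj₁; proj₂; swap; uncurry; map₁; map₂)
open import Data.Sum using (_⊎_; inj₁; inj₂; [_,_]′)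
open import Function using (_∘_; Equivalence; mk⇔)
open import Function.Definitions using (Injective)
open import Relation.Binary.PropositionalEquality using (_≡_; _≢_; refl; sym; trans; cong; cong₂; subst; subst₂)
open import Relation.Binary.Definitions using (tri<; tri≈; tri>; DecidableEquality)
open import Relation.Nullary using (¬_; ¬?; Dec; yes; no; does; contradiction)
import Relation.Nullary.Decidable as Dec
open import Relation.Nullary.Decidable
  using (toWitness; decidable-stable; _×-dec_; _→-dec_; _⊎-dec_; does-⇔; dec-false; dec-true)

private
  variable
    A : Set

unique-⊆⇒length≤ : {xs ys : List A} → Unique xs → xs ⊆ ys → length xs ≤ length ys
unique-⊆⇒length≤ {xs = []} _ _ = z≤n
unique-⊆⇒length≤ {xs = x ∷ xs} {ys} (x∉xs ∷ unique) xs⊆ys with ∈-∃++ (xs⊆ys (here refl))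
... | ys₁ , ys₂ , refl = subst (suc (length xs) ≤_) (sym (length-middle ys₁))
  (s≤s (unique-⊆⇒length≤ unique (λ z∈xs → drop ys₁ (xs⊆ys (there z∈xs)) (All.lookup x∉xs z∈xs))))
  where
  length-middle : ∀ zs → length (zs ++ x ∷ ys₂) ≡ suc (length (zs ++ ys₂))
  length-middle [] = refl
  length-middle (_ ∷ zs) = cong suc (length-middle zs)
  drop : ∀ {z} zs → z ∈ zs ++ x ∷ ys₂ → x ≢ z → z ∈ zs ++ ys₂
  drop [] (here refl) x≢z = contradiction refl x≢z
  drop [] (there z∈) _ = z∈
  drop (_ ∷ zs) (here z≡) _ = here z≡
  drop (_ ∷ zs) (there z∈) x≢z = there (drop zs z∈ x≢z)

unique⇒lookup-injective : {xs : List A} → Unique xs → ∀ i j → lookup xs i ≡ lookup xs j → i ≡ j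
unique⇒lookup-injective (_ ∷ _) Fin.zero Fin.zero _ = refl
unique⇒lookup-injective (x∉xs ∷ _) Fin.zero (Fin.suc j) eq = contradiction eq (All.lookup x∉xs (∈-lookup j))
unique⇒lookup-injective (x∉xs ∷ _) (Fin.suc i) Fin.zero eq = contradiction (sym eq) (All.lookup x∉xs (∈-lookup i))
unique⇒lookup-injective (_ ∷ unique) (Fin.suc i) (Fin.suc j) eq = cong Fin.suc (unique⇒lookup-injective unique i j eq)

length-concatMap : {B : Set} (f : A → List B) {c : ℕ} → (∀ x → length (f x) ≡ c) →
  ∀ xs → length (concatMap f xs) ≡ length xs * c
length-concatMap f fx≡c [] = refl
length-concatMap f fx≡c (x ∷ xs) = trans (length-++ (f x)) (cong₂ _+_ (fx≡c x) (length-concatMap f fx≡c xs))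

does⇒ : {P : Set} (P? : Dec P) → does P? ≡ true → P
does⇒ (yes p) _ = p

Adj : (G : Graph) → Fin (n G) → Fin (n G) → Set
Adj G i j = adj G i j ≡ true

Adj-sym : (G : Graph) {i j : Fin (n G)} → Adj G i j → Adj G j i
Adj-sym G {i} {j} = trans (Graph.sym G j i)

Adj-irrefl : (G : Graph) {i : Fin (n G)} → ¬ Adj G i i
Adj-irrefl G {i} ii = contradiction (trans (sym ii) (Graph.irrefl G i)) λ ()

module _ (G : Graph) where

  private
    isEdge : Fin (n G) × Fin (n G) → Bool
    isEdge (i , j) = (toℕ i <ᵇ toℕ j) ∧ adj G i j

    vertexPairs : List (Fin (n G) × Fin (n G))
    vertexPairs = concatMap (λ i → map (i ,_) (allFin (n G))) (allFin (n G))

  -- By definition, e G is the length of this list.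
  edges : List (Fin (n G) × Fin (n G))
  edges = filterᵇ isEdge vertexPairs

  edges-unique : Unique edges
  edges-unique = Unique.filter⁺ (T? ∘ isEdge) pairs-unique
    where
    cartesian : ∀ (is : List (Fin (n G))) → concatMap (λ i → map (i ,_) (allFin (n G))) is ≡ cartesianProduct is (allFin (n G))
    cartesian [] = refl
    cartesian (i ∷ is) = cong (map (i ,_) (allFin (n G)) ++_) (cartesian is)
    pairs-unique : Unique vertexPairs
    pairs-unique = subst Unique (sym (cartesian (allFin (n G)))) (Unique.cartesianProduct⁺ (Unique.allFin⁺ _) (Unique.allFin⁺ _))

  ∈-edges⁺ : ∀ {i j} → toℕ i < toℕ j → Adj G i j → (i , j) ∈ edges
  ∈-edges⁺ {i} {j} i<j ij =
    ∈-filter⁺ (T? ∘ isEdge) pair∈ (Equivalence.from T-∧ (<⇒<ᵇ i<j , Equivalence.from T-≡ ij))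
    where
    pair∈ : (i , j) ∈ vertexPairs
    pair∈ = ∈-concat⁺′ (∈-map⁺ (i ,_) (∈-allFin j)) (∈-map⁺ (λ i → map (i ,_) (allFin (n G))) (∈-allFin i))

  ∈-edges⁻ : ∀ {i j} → (i , j) ∈ edges → toℕ i < toℕ j × Adj G i j
  ∈-edges⁻ {i} {j} ij∈ with Equivalence.to T-∧ (proj₂ (∈-filter⁻ (T? ∘ isEdge) {xs = vertexPairs} ij∈))
  ... | i<ᵇj , ij = <ᵇ⇒< (toℕ i) (toℕ j) i<ᵇj , Equivalence.to T-≡ ij

  length≤e : {xs : List (Fin (n G) × Fin (n G))} → Unique xs →
    (∀ {i j} → (i , j) ∈ xs → toℕ i < toℕ j × Adj G i j) → length xs ≤ e G
  length≤e unique xs-edges = unique-⊆⇒length≤ unique λ {(i , j)} ij∈ → uncurry ∈-edges⁺ (xs-edges ij∈)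

  e≤length : (ys : List (Fin (n G) × Fin (n G))) →
    (∀ i j → Adj G i j → (i , j) ∈ ys ⊎ (j , i) ∈ ys) → e G ≤ length ys
  e≤length ys covers = subst (e G ≤_) (length-map ordered ys) (unique-⊆⇒length≤ edges-unique edges⊆)
    where
    ordered : Fin (n G) × Fin (n G) → Fin (n G) × Fin (n G)
    ordered (i , j) with toℕ i <ᵇ toℕ j
    ... | true = i , j
    ... | false = j , i
    ordered-< : ∀ {i j} → toℕ i < toℕ j → ordered (i , j) ≡ (i , j) × ordered (j , i) ≡ (i , j)
    ordered-< {i} {j} i<j with toℕ i <ᵇ toℕ j in i<ᵇj | toℕ j <ᵇ toℕ i in j<ᵇi
    ... | true | false = refl , refl
    ... | false | _ = contradiction (subst T i<ᵇj (<⇒<ᵇ i<j)) λ ()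
    ... | true | true = contradiction (<ᵇ⇒< (toℕ j) (toℕ i) (subst T (sym j<ᵇi) _)) (<-asym i<j)
    edges⊆ : edges ⊆ map ordered ys
    edges⊆ {i , j} ij∈ with ∈-edges⁻ ij∈
    ... | i<j , ij with covers i j ij
    ... | inj₁ ij∈ys = subst (_∈ map ordered ys) (proj₁ (ordered-< i<j)) (∈-map⁺ ordered ij∈ys)
    ... | inj₂ ji∈ys = subst (_∈ map ordered ys) (proj₂ (ordered-< i<j)) (∈-map⁺ ordered ji∈ys)

SameEdge : A → A → A → A → Set
SameEdge i j x y = (i ≡ x × j ≡ y) ⊎ (i ≡ y × j ≡ x)

SameEdge-swap : {i j x y : A} → SameEdge i j x y → SameEdge j i x y
SameEdge-swap (inj₁ (i≡x , j≡y)) = inj₂ (j≡y , i≡x)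
SameEdge-swap (inj₂ (i≡y , j≡x)) = inj₁ (j≡x , i≡y)

sameEdge? : DecidableEquality A → (i j x y : A) → Dec (SameEdge i j x y)
sameEdge? _≟_ i j x y = ((i ≟ x) ×-dec (j ≟ y)) ⊎-dec ((i ≟ y) ×-dec (j ≟ x))

SameEdge-trans : {i j a b x y : A} → SameEdge i j a b → SameEdge x y a b → SameEdge i j x y
SameEdge-trans (inj₁ (refl , refl)) (inj₁ (refl , refl)) = inj₁ (refl , refl)
SameEdge-trans (inj₁ (refl , refl)) (inj₂ (refl , refl)) = inj₂ (refl , refl)
SameEdge-trans (inj₂ (refl , refl)) (inj₁ (refl , refl)) = inj₂ (refl , refl)
SameEdge-trans (inj₂ (refl , refl)) (inj₂ (refl , refl)) = inj₁ (refl , refl)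

SameEdge-injective : {B : Set} {f : A → B} → Injective _≡_ _≡_ f →
  ∀ {i j x y} → SameEdge (f i) (f j) (f x) (f y) → SameEdge i j x y
SameEdge-injective f-inj (inj₁ (i≡x , j≡y)) = inj₁ (f-inj i≡x , f-inj j≡y)
SameEdge-injective f-inj (inj₂ (i≡y , j≡x)) = inj₂ (f-inj i≡y , f-inj j≡x)

SameEdge-Adj : (X : Graph) {c : A → Fin (n X)} {i j a b : A} →
  SameEdge i j a b → Adj X (c a) (c b) → Adj X (c i) (c j)
SameEdge-Adj X (inj₁ (refl , refl)) ab = ab
SameEdge-Adj X (inj₂ (refl , refl)) ab = Adj-sym X ab

deleteEdge : (G : Graph) → Fin (n G) → Fin (n G) → Graph
deleteEdge G x y = record
  { n = n G
  ; adj = λ i j → adj G i j ∧ not (does (sameEdge? _≟_ i j x y))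
  ; sym = λ i j → cong₂ (λ a b → a ∧ not b) (Graph.sym G i j)
                    (does-⇔ (mk⇔ SameEdge-swap SameEdge-swap) (sameEdge? _≟_ i j x y) (sameEdge? _≟_ j i x y))
  ; irrefl = λ i → cong (_∧ _) (Graph.irrefl G i)
  }

module _ (G : Graph) {x y : Fin (n G)} where

  deleteEdge-adj⁺ : ∀ {i j} → Adj G i j → ¬ SameEdge i j x y → Adj (deleteEdge G x y) i j
  deleteEdge-adj⁺ {i} {j} ij different rewrite ij | dec-false (sameEdge? _≟_ i j x y) different = refl

  deleteEdge-adj⁻ : ∀ {i j} → Adj (deleteEdge G x y) i j → Adj G i j × ¬ SameEdge i j x y
  deleteEdge-adj⁻ {i} {j} = ∧-not-does (sameEdge? _≟_ i j x y)
    where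
    ∧-not-does : ∀ {a} {P : Set} (P? : Dec P) → a ∧ not (does P?) ≡ true → a ≡ true × ¬ P
    ∧-not-does {true} (no ¬p) _ = refl , ¬p

  deleteEdge-proper : Adj G x y → ProperSubgraph (deleteEdge G x y) G
  deleteEdge-proper xy = ((λ i → i) , (λ eq → eq) , λ i j → proj₁ ∘ deleteEdge-adj⁻) , +-monoʳ-< (n G) fewerEdges
    where
    missing : ∀ {a b} → toℕ a < toℕ b → Adj G a b → SameEdge a b x y → e (deleteEdge G x y) < e G
    missing {a} {b} a<b ab same = length≤e G (All.tabulate fresh ∷ edges-unique (deleteEdge G x y)) all-edges
      where
      fresh : ∀ {p} → p ∈ edges (deleteEdge G x y) → (a , b) ≢ p
      fresh p∈ refl = proj₂ (deleteEdge-adj⁻ (proj₂ (∈-edges⁻ (deleteEdge G x y) p∈))) same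
      all-edges : ∀ {i j} → (i , j) ∈ (a , b) ∷ edges (deleteEdge G x y) → toℕ i < toℕ j × Adj G i j
      all-edges (here refl) = a<b , ab
      all-edges (there ij∈) = map₂ (proj₁ ∘ deleteEdge-adj⁻) (∈-edges⁻ (deleteEdge G x y) ij∈)
    fewerEdges : e (deleteEdge G x y) < e G
    fewerEdges with <-cmp x y
    ... | tri< x<y _ _ = missing x<y xy (inj₁ (refl , refl))
    ... | tri≈ _ refl _ = contradiction xy (Adj-irrefl G)
    ... | tri> _ _ y<x = missing y<x (Adj-sym G xy) (inj₂ (refl , refl))

induced : (G : Graph) {k : ℕ} → (Fin k → Fin (n G)) → Graph
induced G {k} f = record
  { n = k
  ; adj = λ i j → adj G (f i) (f j)
  ; sym = λ i j → Graph.sym G (f i) (f j)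
  ; irrefl = λ i → Graph.irrefl G (f i)
  }

e-induced≤ : (G : Graph) {k : ℕ} (f : Fin k → Fin (n G)) →
  (∀ {i j} → toℕ i < toℕ j → toℕ (f i) < toℕ (f j)) → e (induced G f) ≤ e G
e-induced≤ G f f-mono = subst (_≤ e G) (length-map f² (edges (induced G f)))
  (length≤e G (Unique.map⁺ f²-injective (edges-unique (induced G f))) image-edges)
  where
  f² : _ → Fin (n G) × Fin (n G)
  f² (i , j) = f i , f j
  f-injective : ∀ {i j} → f i ≡ f j → i ≡ j
  f-injective {i} {j} fi≡fj with <-cmp i j
  ... | tri< i<j _ _ = contradiction (f-mono i<j) (<-irrefl (cong toℕ fi≡fj))
  ... | tri≈ _ i≡j _ = i≡j
  ... | tri> _ _ j<i = contradiction (f-mono j<i) (<-irrefl (cong toℕ (sym fi≡fj)))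
  f²-injective : ∀ {p q} → f² p ≡ f² q → p ≡ q
  f²-injective eq = cong₂ _,_ (f-injective (cong proj₁ eq)) (f-injective (cong proj₂ eq))
  image-edges : ∀ {x y} → (x , y) ∈ map f² (edges (induced G f)) → toℕ x < toℕ y × Adj G x y
  image-edges xy∈ with ∈-map⁻ f² xy∈
  ... | (i , j) , ij∈ , refl = map₁ f-mono (∈-edges⁻ (induced G f) ij∈)

critical⇒nonIsolated : {X : Graph} (G : Graph) → Fin (n X) → Critical X G → ∀ a → ∃[ b ] Adj G a b
critical⇒nonIsolated {X} G@record { n = suc N } c₀ (no-hom , proper-hom) a with any? (λ b → adj G a b ≟ᵇ true)
... | yes neighbour = neighbour
... | no isolated = contradiction (colour , colour-hom) no-hom
  where
  punchIn-mono : ∀ {i j} → toℕ i < toℕ j → toℕ (punchIn a i) < toℕ (punchIn a j)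
  punchIn-mono {i} {j} i<j = ≤∧≢⇒< (punchIn-mono-≤ a i j (<⇒≤ i<j))
    (λ eq → <-irrefl (cong toℕ (punchIn-injective a i j (toℕ-injective eq))) i<j)
  rest : Hom (induced G (punchIn a)) X
  rest = proper-hom (induced G (punchIn a)) ((punchIn a , punchIn-injective a _ _ , λ _ _ ij → ij) ,
    s≤s (+-monoʳ-≤ N (e-induced≤ G (punchIn a) punchIn-mono)))
  colour : Fin (suc N) → Fin (n X)
  colour b with a ≟ b
  ... | yes _ = c₀
  ... | no a≢b = proj₁ rest (punchOut a≢b)
  colour-hom : ∀ i j → Adj G i j → Adj X (colour i) (colour j)
  colour-hom i j ij with a ≟ i | a ≟ j
  ... | yes refl | _ = contradiction (j , ij) isolated
  ... | no _ | yes refl = contradiction (i , Adj-sym G ij) isolated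
  ... | no a≢i | no a≢j = proj₂ rest _ _
    (subst₂ (Adj G) (sym (punchIn-punchOut a≢i)) (sym (punchIn-punchOut a≢j)) ij)

Hom-trans : {G H K : Graph} → Hom G H → Hom H K → Hom G K
Hom-trans (f , f-hom) (g , g-hom) = g ∘ f , λ i j → g-hom (f i) (f j) ∘ f-hom i j

surjective⇒≤ : ∀ {a b} (f : Fin a → Fin b) → (∀ y → ∃[ x ] f x ≡ y) → b ≤ a
surjective⇒≤ f surjective = injective⇒≤ {f = proj₁ ∘ surjective} λ {y} {y′} eq →
  trans (sym (proj₂ (surjective y))) (trans (cong f eq) (proj₂ (surjective y′)))

module _ (H G : Graph) (f : Fin (n H) → Fin (n G)) where

  Covered : Fin (n G) → Fin (n G) → Set
  Covered x y = ∃₂ λ i j → Adj H i j × f i ≡ x × f j ≡ y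

  covered? : ∀ x y → Dec (Covered x y)
  covered? x y = any? λ i → any? λ j → (adj H i j ≟ᵇ true) ×-dec (f i ≟ x) ×-dec (f j ≟ y)

  covering⇒v+e≤ : (∀ x → ∃[ y ] Adj G x y) → (∀ x y → Adj G x y → Covered x y) →
    v G + e G ≤ v H + e H
  covering⇒v+e≤ nonIsolated covering = +-mono-≤ (surjective⇒≤ f onto) edgeBound
    where
    onto : ∀ x → ∃[ i ] f i ≡ x
    onto x with covering x _ (proj₂ (nonIsolated x))
    ... | i , _ , _ , fi≡x , _ = i , fi≡x
    f² : Fin (n H) × Fin (n H) → Fin (n G) × Fin (n G)
    f² (i , j) = f i , f j
    edgeBound : e G ≤ e H
    edgeBound = subst (e G ≤_) (length-map f² (edges H)) (e≤length G (map f² (edges H)) image)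
      where
      image : ∀ x y → Adj G x y → (x , y) ∈ map f² (edges H) ⊎ (y , x) ∈ map f² (edges H)
      image x y xy with covering x y xy
      ... | i , j , ij , refl , refl with <-cmp i j
      ... | tri< i<j _ _ = inj₁ (∈-map⁺ f² (∈-edges⁺ H i<j ij))
      ... | tri≈ _ refl _ = contradiction ij (Adj-irrefl H)
      ... | tri> _ _ j<i = inj₂ (∈-map⁺ f² (∈-edges⁺ H j<i (Adj-sym H ij)))

  uncovered⇒hom : ∀ {x y} → ¬ Covered x y → (∀ i j → Adj H i j → Adj G (f i) (f j)) → Hom H (deleteEdge G x y)
  uncovered⇒hom uncovered f-hom = f , λ i j ij → deleteEdge-adj⁺ G (f-hom i j ij) λ where
    (inj₁ (fi≡x , fj≡y)) → uncovered (i , j , ij , fi≡x , fj≡y)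
    (inj₂ (fi≡y , fj≡x)) → uncovered (j , i , Adj-sym H ij , fj≡x , fi≡y)

edgeCritical⇒critical : {X G : Graph} → (∀ a → ∃[ b ] Adj G a b) → ¬ Hom G X →
  (∀ x y → Adj G x y → Hom (deleteEdge G x y) X) → Critical X G
edgeCritical⇒critical {X} {G} nonIsolated no-hom deletions = no-hom , proper-hom
  where
  proper-hom : ∀ H → ProperSubgraph H G → Hom H X
  proper-hom H ((f , _ , f-hom) , smaller)
    with any? (λ x → any? λ y → (adj G x y ≟ᵇ true) ×-dec ¬? (covered? H G f x y))
  ... | yes (x , y , xy , uncovered) = Hom-trans {H} {deleteEdge G x y} {X} (uncovered⇒hom H G f uncovered f-hom) (deletions x y xy)
  ... | no allCovered = contradiction (covering⇒v+e≤ H G f nonIsolated covering) (<⇒≱ smaller)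
    where
    covering : ∀ x y → Adj G x y → Covered H G f x y
    covering x y xy = decidable-stable (covered? H G f x y) λ uncovered → allCovered (x , y , xy , uncovered)

Walk₃ : (X : Graph) → Fin (n X) → Fin (n X) → Set
Walk₃ X x y = ∃₂ λ a b → Adj X x a × Adj X a b × Adj X b y

module Subdivision (G : Graph) where

  private
    m : ℕ
    m = e G

  src dst : Fin m → Fin (n G)
  src k = proj₁ (lookup (edges G) k)
  dst k = proj₂ (lookup (edges G) k)

  src<dst : ∀ k → toℕ (src k) < toℕ (dst k)
  src<dst k = proj₁ (∈-edges⁻ G (∈-lookup k))

  src-dst-adj : ∀ k → Adj G (src k) (dst k)
  src-dst-adj k = proj₂ (∈-edges⁻ G (∈-lookup k))

  ∈-edges⇒index : ∀ {a b} → (a , b) ∈ edges G → ∃[ k ] (a ≡ src k × b ≡ dst k)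
  ∈-edges⇒index ab∈ = index ab∈ , cong proj₁ (lookup-index ab∈) , cong proj₂ (lookup-index ab∈)

  edge⇒index : ∀ {a b} → Adj G a b → ∃[ k ] SameEdge a b (src k) (dst k)
  edge⇒index {a} {b} ab with <-cmp a b
  ... | tri< a<b _ _ = map₂ inj₁ (∈-edges⇒index (∈-edges⁺ G a<b ab))
  ... | tri≈ _ refl _ = contradiction ab (Adj-irrefl G)
  ... | tri> _ _ b<a = map₂ (inj₂ ∘ swap) (∈-edges⇒index (∈-edges⁺ G b<a (Adj-sym G ab)))

  index-unique : ∀ {k l} → SameEdge (src k) (dst k) (src l) (dst l) → k ≡ l
  index-unique {k} {l} (inj₁ (src≡ , dst≡)) = unique⇒lookup-injective (edges-unique G) k l (cong₂ _,_ src≡ dst≡)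
  index-unique {k} {l} (inj₂ (src≡ , dst≡)) =
    contradiction (subst₂ (λ a b → toℕ a < toℕ b) src≡ dst≡ (src<dst k)) (<-asym (src<dst l))

  data Vertex : Set where
    orig : Fin (n G) → Vertex
    inner₁ inner₂ : Fin m → Vertex

  toFin : Vertex → Fin (n G + (m + m))
  toFin (orig a) = a ↑ˡ (m + m)
  toFin (inner₁ k) = n G ↑ʳ (k ↑ˡ m)
  toFin (inner₂ k) = n G ↑ʳ (m ↑ʳ k)

  fromFin : Fin (n G + (m + m)) → Vertex
  fromFin x = [ orig , [ inner₁ , inner₂ ]′ ∘ splitAt m ]′ (splitAt (n G) x)

  fromFin-toFin : ∀ u → fromFin (toFin u) ≡ u
  fromFin-toFin (orig a) rewrite splitAt-↑ˡ (n G) a (m + m) = refl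
  fromFin-toFin (inner₁ k) rewrite splitAt-↑ʳ (n G) (m + m) (k ↑ˡ m) | splitAt-↑ˡ m k m = refl
  fromFin-toFin (inner₂ k) rewrite splitAt-↑ʳ (n G) (m + m) (m ↑ʳ k) | splitAt-↑ʳ m m k = refl

  toFin-fromFin : ∀ x → toFin (fromFin x) ≡ x
  toFin-fromFin x with splitAt (n G) x in eq
  ... | inj₁ a = splitAt⁻¹-↑ˡ eq
  ... | inj₂ y with splitAt m y in eq′
  ...   | inj₁ k = trans (cong (n G ↑ʳ_) (splitAt⁻¹-↑ˡ eq′)) (splitAt⁻¹-↑ʳ eq)
  ...   | inj₂ k = trans (cong (n G ↑ʳ_) (splitAt⁻¹-↑ʳ eq′)) (splitAt⁻¹-↑ʳ eq)

  fromFin-injective : Injective _≡_ _≡_ fromFin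
  fromFin-injective {x} {y} eq = trans (sym (toFin-fromFin x)) (trans (cong toFin eq) (toFin-fromFin y))

  _≟ᵛ_ : DecidableEquality Vertex
  u ≟ᵛ w = Dec.map′ (λ eq → trans (sym (fromFin-toFin u)) (trans (cong fromFin eq) (fromFin-toFin w)))
                    (cong toFin) (toFin u ≟ toFin w)

  data Step : Set where
    first middle last : Step

  any-step? : {P : Step → Set} → (∀ s → Dec (P s)) → Dec (∃ P)
  any-step? P? with P? first | P? middle | P? last
  ... | yes p | _ | _ = yes (first , p)
  ... | no _ | yes p | _ = yes (middle , p)
  ... | no _ | no _ | yes p = yes (last , p)
  ... | no ¬p | no ¬q | no ¬r = no λ where
    (first , p) → ¬p p
    (middle , q) → ¬q q
    (last , r) → ¬r r

  stepFrom stepTo : Fin m → Step → Vertex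
  stepFrom k first = orig (src k)
  stepFrom k middle = inner₁ k
  stepFrom k last = inner₂ k
  stepTo k first = inner₁ k
  stepTo k middle = inner₂ k
  stepTo k last = orig (dst k)

  stepPair : Fin m → Step → Vertex × Vertex
  stepPair k s = stepFrom k s , stepTo k s

  step-loopless : ∀ k s → stepFrom k s ≢ stepTo k s
  step-loopless k first ()
  step-loopless k middle ()
  step-loopless k last ()

  Link : Vertex → Vertex → Set
  Link u w = ∃₂ λ k s → SameEdge u w (stepFrom k s) (stepTo k s)

  -- Abstract only so that type checking never unfolds this search.
  abstract
    link? : ∀ u w → Dec (Link u w)
    link? u w = any? λ k → any-step? λ s → sameEdge? _≟ᵛ_ u w (stepFrom k s) (stepTo k s)

  Link-sym : ∀ {u w} → Link u w → Link w u
  Link-sym (k , s , same) = k , s , SameEdge-swap same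

  Link-irrefl : ∀ {u} → ¬ Link u u
  Link-irrefl (k , s , inj₁ (refl , eq)) = step-loopless k s eq
  Link-irrefl (k , s , inj₂ (refl , eq)) = step-loopless k s (sym eq)

  graph : Graph
  graph = record
    { n = n G + (m + m)
    ; adj = λ x y → does (link? (fromFin x) (fromFin y))
    ; sym = λ x y → does-⇔ (mk⇔ Link-sym Link-sym) (link? (fromFin x) (fromFin y)) (link? (fromFin y) (fromFin x))
    ; irrefl = λ x → dec-false (link? (fromFin x) (fromFin x)) Link-irrefl
    }

  Link⇒Adj : ∀ {x y} → Link (fromFin x) (fromFin y) → Adj graph x y
  Link⇒Adj {x} {y} = dec-true (link? (fromFin x) (fromFin y))

  Adj⇒Link : ∀ {x y} → Adj graph x y → Link (fromFin x) (fromFin y)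
  Adj⇒Link {x} {y} = does⇒ (link? (fromFin x) (fromFin y))

  step-adj : ∀ k s → Adj graph (toFin (stepFrom k s)) (toFin (stepTo k s))
  step-adj k s = Link⇒Adj (k , s , inj₁ (fromFin-toFin (stepFrom k s) , fromFin-toFin (stepTo k s)))

  e-graph≤ : e graph ≤ 3 * m
  e-graph≤ = subst (e graph ≤_) length-stepList (e≤length graph stepList onList)
    where
    steps : List Step
    steps = first ∷ middle ∷ last ∷ []
    ∈-steps : ∀ s → s ∈ steps
    ∈-steps first = here refl
    ∈-steps middle = there (here refl)
    ∈-steps last = there (there (here refl))
    toFin² : Vertex × Vertex → Fin (n graph) × Fin (n graph)
    toFin² (u , w) = toFin u , toFin w
    stepsOf : Fin m → List (Fin (n graph) × Fin (n graph))
    stepsOf k = map (toFin² ∘ stepPair k) steps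
    stepList : List (Fin (n graph) × Fin (n graph))
    stepList = concatMap stepsOf (allFin m)
    length-stepList : length stepList ≡ 3 * m
    length-stepList = trans (length-concatMap stepsOf (λ _ → refl) (allFin m))
      (trans (cong (_* 3) (length-tabulate {n = m} (λ k → k))) (*-comm m 3))
    ∈-stepList : ∀ k s → toFin² (stepPair k s) ∈ stepList
    ∈-stepList k s = ∈-concat⁺′ (∈-map⁺ (toFin² ∘ stepPair k) (∈-steps s)) (∈-map⁺ stepsOf (∈-allFin k))
    link∈ : ∀ {u w} → Link u w → toFin² (u , w) ∈ stepList ⊎ toFin² (w , u) ∈ stepList
    link∈ (k , s , inj₁ (refl , refl)) = inj₁ (∈-stepList k s)
    link∈ (k , s , inj₂ (refl , refl)) = inj₂ (∈-stepList k s)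
    onList : ∀ x y → Adj graph x y → (x , y) ∈ stepList ⊎ (y , x) ∈ stepList
    onList x y xy = subst₂ (λ a b → (a , b) ∈ stepList ⊎ (b , a) ∈ stepList)
      (toFin-fromFin x) (toFin-fromFin y) (link∈ (Adj⇒Link xy))

  nonIsolated : (∀ a → ∃[ b ] Adj G a b) → ∀ x → ∃[ y ] Adj graph x y
  nonIsolated G-nonIsolated x with neighbour (fromFin x)
    where
    neighbour : ∀ u → ∃[ w ] Link u w
    neighbour (orig a) with edge⇒index (proj₂ (G-nonIsolated a))
    ... | k , inj₁ (refl , _) = inner₁ k , k , first , inj₁ (refl , refl)
    ... | k , inj₂ (refl , _) = inner₂ k , k , last , inj₂ (refl , refl)
    neighbour (inner₁ k) = inner₂ k , k , middle , inj₁ (refl , refl)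
    neighbour (inner₂ k) = inner₁ k , k , middle , inj₂ (refl , refl)
  ... | w , link = toFin w , Link⇒Adj (subst (Link (fromFin x)) (sym (fromFin-toFin w)) link)

  module _ {X Y : Graph} (φ : Fin (n X) → Fin (n Y)) (φ-walk : ∀ {x y} → Walk₃ X x y → Adj Y (φ x) (φ y)) where

    contract : Hom graph X → Hom G Y
    contract (c , c-hom) = φ ∘ c ∘ toFin ∘ orig , h-hom
      where
      c-step : ∀ k s → Adj X (c (toFin (stepFrom k s))) (c (toFin (stepTo k s)))
      c-step k s = c-hom _ _ (step-adj k s)
      h-hom : ∀ a b → Adj G a b → Adj Y (φ (c (toFin (orig a)))) (φ (c (toFin (orig b))))
      h-hom a b ab with edge⇒index ab
      ... | k , same = SameEdge-Adj Y {c = φ ∘ c ∘ toFin ∘ orig} same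
        (φ-walk (_ , _ , c-step k first , c-step k middle , c-step k last))

  module Expand {X Y : Graph} (ψ : Fin (n Y) → Fin (n X)) (ψ-walk : ∀ {p q} → Adj Y p q → Walk₃ X (ψ p) (ψ q))
    (neighbour : Fin (n X) → Fin (n X)) (neighbour-adj : ∀ x → Adj X x (neighbour x))
    (k₀ : Fin m) (s₀ : Step) (h : Hom (deleteEdge G (src k₀) (dst k₀)) Y) where

    private
      α β : Fin (n X)
      α = ψ (proj₁ h (src k₀))
      β = ψ (proj₁ h (dst k₀))

    h-adj : ∀ {k} → k ≢ k₀ → Adj Y (proj₁ h (src k)) (proj₁ h (dst k))
    h-adj k≢k₀ = proj₂ h _ _ (deleteEdge-adj⁺ G (src-dst-adj _) (k≢k₀ ∘ index-unique))

    -- Inner colours of k₀'s path with the given step deleted: each inner vertex hangs off the end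
    -- it is still joined to.
    detour : Step → Fin (n X) × Fin (n X)
    detour first = neighbour (neighbour β) , neighbour β
    detour middle = neighbour α , neighbour β
    detour last = neighbour α , neighbour (neighbour α)

    innerColours : (k : Fin m) → Dec (k ≡ k₀) → Fin (n X) × Fin (n X)
    innerColours k (yes _) = detour s₀
    innerColours k (no k≢k₀) = let (a , b , _) = ψ-walk (h-adj k≢k₀) in a , b

    colour : Vertex → Fin (n X)
    colour (orig a) = ψ (proj₁ h a)
    colour (inner₁ k) = proj₁ (innerColours k (k ≟ k₀))
    colour (inner₂ k) = proj₂ (innerColours k (k ≟ k₀))

    StepColoured : Fin m → Step → Fin (n X) × Fin (n X) → Set
    StepColoured k first (a , _) = Adj X (ψ (proj₁ h (src k))) a
    StepColoured k middle (a , b) = Adj X a b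
    StepColoured k last (_ , b) = Adj X b (ψ (proj₁ h (dst k)))

    walk-coloured : ∀ k s {a b} → Adj X (ψ (proj₁ h (src k))) a → Adj X a b → Adj X b (ψ (proj₁ h (dst k))) →
      StepColoured k s (a , b)
    walk-coloured k first xa _ _ = xa
    walk-coloured k middle _ ab _ = ab
    walk-coloured k last _ _ by = by

    detour-coloured : ∀ deleted s → stepPair k₀ s ≢ stepPair k₀ deleted → StepColoured k₀ s (detour deleted)
    detour-coloured first first ne = contradiction refl ne
    detour-coloured first middle _ = Adj-sym X (neighbour-adj (neighbour β))
    detour-coloured first last _ = Adj-sym X (neighbour-adj β)
    detour-coloured middle first _ = neighbour-adj α
    detour-coloured middle middle ne = contradiction refl ne
    detour-coloured middle last _ = Adj-sym X (neighbour-adj β)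
    detour-coloured last first _ = neighbour-adj α
    detour-coloured last middle _ = neighbour-adj (neighbour α)
    detour-coloured last last ne = contradiction refl ne

    innerColours-coloured : ∀ k s (d : Dec (k ≡ k₀)) → stepPair k s ≢ stepPair k₀ s₀ →
      StepColoured k s (innerColours k d)
    innerColours-coloured k s (yes refl) ne = detour-coloured s₀ s ne
    innerColours-coloured k s (no k≢k₀) _ with ψ-walk (h-adj k≢k₀)
    ... | _ , _ , xa , ab , by = walk-coloured k s xa ab by

    colour-step : ∀ k s → stepPair k s ≢ stepPair k₀ s₀ → Adj X (colour (stepFrom k s)) (colour (stepTo k s))
    colour-step k first = innerColours-coloured k first (k ≟ k₀)
    colour-step k middle = innerColours-coloured k middle (k ≟ k₀)
    colour-step k last = innerColours-coloured k last (k ≟ k₀)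

    expand : ∀ {x y} → SameEdge (fromFin x) (fromFin y) (stepFrom k₀ s₀) (stepTo k₀ s₀) →
      Hom (deleteEdge graph x y) X
    expand {x} {y} deleted = colour ∘ fromFin , λ i j ij → colour-adj (deleteEdge-adj⁻ graph ij)
      where
      colour-adj : ∀ {i j} → Adj graph i j × ¬ SameEdge i j x y → Adj X (colour (fromFin i)) (colour (fromFin j))
      colour-adj (ij , kept) with Adj⇒Link ij
      ... | k , s , same with ≡-dec _≟ᵛ_ _≟ᵛ_ (stepPair k s) (stepPair k₀ s₀)
      ... | no distinct = SameEdge-Adj X {c = colour} same (colour-step k s distinct)
      ... | yes eq = contradiction (SameEdge-injective fromFin-injective
            (SameEdge-trans (subst (λ p → SameEdge _ _ (proj₁ p) (proj₂ p)) eq same) deleted)) kept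

scale : ℕ → Fin 7 → Fin 7
scale k i = (k * toℕ i) mod 7

next : Fin 7 → Fin 7
next i = suc (toℕ i) mod 7

walk₃? : ∀ x y → Dec (Walk₃ C7 x y)
walk₃? x y = any? λ a → any? λ b → (adj C7 x a ≟ᵇ true) ×-dec (adj C7 a b ≟ᵇ true) ×-dec (adj C7 b y ≟ᵇ true)

-- In ℤ₇, C₇ has connection set ±1 and G₇,₂ has ±2, ±3. A 3-walk of C₇ moves by ±1 or ±3, which 3·_ turns
-- into ±3 or ±2; conversely 5 = 3⁻¹ turns ±2, ±3 into ±3, ±1, both reachable by 3-walks.
C7-walk₃⇒G72 : ∀ {x y} → Walk₃ C7 x y → Adj G72 (scale 3 x) (scale 3 y)
C7-walk₃⇒G72 {x} {y} = toWitness {a? = all? λ x → all? λ y →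
  walk₃? x y →-dec (adj G72 (scale 3 x) (scale 3 y) ≟ᵇ true)} _ x y

G72⇒C7-walk₃ : ∀ {p q} → Adj G72 p q → Walk₃ C7 (scale 5 p) (scale 5 q)
G72⇒C7-walk₃ {p} {q} = toWitness {a? = all? λ p → all? λ q →
  (adj G72 p q ≟ᵇ true) →-dec walk₃? (scale 5 p) (scale 5 q)} _ p q

C7-next : ∀ x → Adj C7 x (next x)
C7-next = toWitness {a? = all? λ x → adj C7 x (next x) ≟ᵇ true} _

subdivision-critical : (G : Graph) → Critical G72 G → Critical C7 (Subdivision.graph G)
subdivision-critical G crit@(no-hom , proper-hom) = edgeCritical⇒critical {C7} {graph}
  (nonIsolated (critical⇒nonIsolated {G72} G Fin.zero crit))
  (no-hom ∘ contract {C7} {G72} (scale 3) λ {x} {y} → C7-walk₃⇒G72 {x} {y})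
  deletion
  where
  open Subdivision G
  deletion : ∀ x y → Adj graph x y → Hom (deleteEdge graph x y) C7
  deletion x y xy with Adj⇒Link xy
  ... | k , s , deleted = Expand.expand {C7} {G72} (scale 5) (λ {p} {q} → G72⇒C7-walk₃ {p} {q}) next C7-next k s
    (proper-hom (deleteEdge G (src k) (dst k)) (deleteEdge-proper G (src-dst-adj k))) deleted

subdivision-arithmetic : ∀ N m s → s ≤ 3 * m → 27 * (N + (m + m)) ≤ 23 * s + 20 → 27 * N ≤ 15 * m + 20
subdivision-arithmetic N m s s≤3m bound = +-cancelʳ-≤ (54 * m) (27 * N) (15 * m + 20)
  (subst₂ _≤_ lhs rhs (≤-trans bound (+-monoˡ-≤ 20 (*-monoʳ-≤ 23 s≤3m))))
  where
  open +-*-Solver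
  lhs : 27 * (N + (m + m)) ≡ 27 * N + 54 * m
  lhs = solve 2 (λ N m → con 27 :* (N :+ (m :+ m)) := con 27 :* N :+ con 54 :* m) refl N m
  rhs : 23 * (3 * m) + 20 ≡ (15 * m + 20) + 54 * m
  rhs = solve 1 (λ m → con 23 :* (con 3 :* m) :+ con 20 := (con 15 :* m :+ con 20) :+ con 54 :* m) refl m

mainTheorem4 : (∀ H → Critical C7 H → 27 * v H ≤ 23 * e H + 20)
    → ∀ G → Critical G72 G → 27 * v G ≤ 15 * e G + 20
mainTheorem4 C7-bound G crit = subdivision-arithmetic (v G) (e G) (e (Subdivision.graph G))
  (Subdivision.e-graph≤ G) (C7-bound (Subdivision.graph G) (subdivision-critical G crit))
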